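{- Let $\mathbf{C}$ be a locally small category, $\Omega$ an object, $\Phi\colon\mathbf{C}^{\mathrm{op}}\to\mathbf{Pos}$ a functor whose fibres have arbitrary meets preserved by all reindexing maps $f^*:=\Phi f$, $d_\Omega\in\Phi\Omega$, and $\alpha_X,\gamma_X$, $\mathrm{cl}_X=\gamma_X\circ\alpha_X$ as in the context. Let $F\colon\mathbf{C}\to\mathbf{C}$ be a functor with morphisms $(\mathrm{ev}_\lambda\colon F\Omega\to\Omega)_{\lambda\in\Lambda}$ and induced $\Lambda_X$, and put $K_X=\alpha_{FX}\circ\Lambda_X\circ\gamma_X\colon\Phi X\to\Phi(FX)$. Let $\mathrm{cl}'_X$ be a closure on $\mathcal{P}(\mathbf{C}(X,\Omega))$ with $\mathrm{cl}'_X(S)\subseteq\mathrm{cl}_X(S)$ for all $S$. Then $\mathrm{cl}'_X$ is compatible (i.e. $\Lambda_X(\mathrm{cl}'_X(\mathrm{cl}_X(S)))\subseteq\mathrm{cl}_{FX}(\Lambda_X(\mathrm{cl}'_X(S)))$ for all $S$) if and only if the depth-1 self-separation property holds: for every $S\subseteq\mathbf{C}(X,\Omega)$ with $\mathrm{cl}'_X(S)=S$ and every $d\in\Phi X$ such that $S$ is initial for $d$, the set $\Lambda_X(S)$ is initial for $K_X(d)$.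
   Context: $\alpha_X(S)=\bigwedge_{k\in S}k^*(d_\Omega)$; $\gamma_X(d)=\{k\in\mathbf{C}(X,\Omega)\mid d\preceq k^*(d_\Omega)\}$; $\Lambda_X(S)=\{\mathrm{ev}_\lambda\circ Fh\mid\lambda\in\Lambda,h\in S\}$. A set $S\subseteq\mathbf{C}(Y,\Omega)$ is initial for $d\in\Phi Y$ if $\alpha_Y(S)=d$. A closure is a monotone, idempotent, extensive map. -}

module Defs where

open import Level using (Level; 0ℓ) renaming (suc to lsuc)
open import Relation.Binary.Bundles using (Poset)
open import Relation.Binary.PropositionalEquality using (_≡_)
open import Relation.Unary using (Pred; _⊆_; _≐_; _∈_)
open import Data.Product using (Σ; ∃; _×_; _,_)

record Category (o : Level) : Set (lsuc o) where
  infixr 9 _∘_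
  field
    Obj       : Set o
    Hom       : Obj → Obj → Set
    id        : ∀ {X} → Hom X X
    _∘_       : ∀ {X Y Z} → Hom Y Z → Hom X Y → Hom X Z
    identityˡ : ∀ {X Y} (f : Hom X Y) → id ∘ f ≡ f
    identityʳ : ∀ {X Y} (f : Hom X Y) → f ∘ id ≡ f
    assoc     : ∀ {W X Y Z} (h : Hom Y Z) (g : Hom X Y) (f : Hom W X) →
                (h ∘ g) ∘ f ≡ h ∘ (g ∘ f)

-- A functor Φ : C^op → Pos whose fibres have arbitrary (Set-indexed) meets,
-- preserved by every reindexing map f^* = Φ f.
record MeetFibration {o : Level} (C : Category o) : Set (lsuc 0ℓ Level.⊔ o) where
  open Category C
  field
    fib : Obj → Poset 0ℓ 0ℓ 0ℓ
  Fib : Obj → Set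
  Fib X = Poset.Carrier (fib X)
  field
    reindex     : ∀ {X Y} → Hom X Y → Fib Y → Fib X
    reindex-mono : ∀ {X Y} (f : Hom X Y) {d e : Fib Y} →
                   Poset._≤_ (fib Y) d e → Poset._≤_ (fib X) (reindex f d) (reindex f e)
    reindex-id  : ∀ {X} (d : Fib X) → Poset._≈_ (fib X) (reindex id d) d
    reindex-∘   : ∀ {X Y Z} (g : Hom Y Z) (f : Hom X Y) (d : Fib Z) →
                  Poset._≈_ (fib X) (reindex (g ∘ f) d) (reindex f (reindex g d))
    ⋀           : ∀ X {I : Set} → (I → Fib X) → Fib X
    ⋀-lb        : ∀ X {I : Set} (u : I → Fib X) (i : I) → Poset._≤_ (fib X) (⋀ X u) (u i)
    ⋀-glb       : ∀ X {I : Set} (u : I → Fib X) (d : Fib X) →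
                  (∀ i → Poset._≤_ (fib X) d (u i)) → Poset._≤_ (fib X) d (⋀ X u)
    reindex-⋀   : ∀ {X Y} (f : Hom X Y) {I : Set} (u : I → Fib Y) →
                  Poset._≈_ (fib X) (reindex f (⋀ Y u)) (⋀ X (λ i → reindex f (u i)))

record Endofunctor {o : Level} (C : Category o) : Set o where
  open Category C
  field
    F₀     : Obj → Obj
    F₁     : ∀ {X Y} → Hom X Y → Hom (F₀ X) (F₀ Y)
    F-id   : ∀ {X} → F₁ (id {X}) ≡ id
    F-∘    : ∀ {X Y Z} (g : Hom Y Z) (f : Hom X Y) → F₁ (g ∘ f) ≡ F₁ g ∘ F₁ f

record IsClosure {A : Set} (c : Pred A 0ℓ → Pred A 0ℓ) : Set₁ where
  field
    monotone   : ∀ {S T} → S ⊆ T → c S ⊆ c T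
    idempotent : ∀ S → c (c S) ≐ c S
    extensive  : ∀ S → S ⊆ c S

module Setting {o : Level} (C : Category o) (Φ : MeetFibration C)
               (Ω : Category.Obj C) (dΩ : MeetFibration.Fib Φ Ω)
               (F : Endofunctor C) (Λ : Set)
               (ev : Λ → Category.Hom C (Endofunctor.F₀ F Ω) Ω) where
  open Category C
  open MeetFibration Φ
  open Endofunctor F

  α : ∀ X → Pred (Hom X Ω) 0ℓ → Fib X
  α X S = ⋀ X {Σ (Hom X Ω) S} (λ { (k , _) → reindex k dΩ })

  γ : ∀ X → Fib X → Pred (Hom X Ω) 0ℓ
  γ X d k = Poset._≤_ (fib X) d (reindex k dΩ)

  cl : ∀ X → Pred (Hom X Ω) 0ℓ → Pred (Hom X Ω) 0ℓ
  cl X S = γ X (α X S)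

  ΛX : ∀ X → Pred (Hom X Ω) 0ℓ → Pred (Hom (F₀ X) Ω) 0ℓ
  ΛX X S k = ∃ λ (l : Λ) → ∃ λ (h : Hom X Ω) → h ∈ S × k ≡ ev l ∘ F₁ h

  K : ∀ X → Fib X → Fib (F₀ X)
  K X d = α (F₀ X) (ΛX X (γ X d))

  Initial : ∀ Y → Pred (Hom Y Ω) 0ℓ → Fib Y → Set
  Initial Y S d = Poset._≈_ (fib Y) (α Y S) d

  Compatible : ∀ X → (Pred (Hom X Ω) 0ℓ → Pred (Hom X Ω) 0ℓ) → Set₁
  Compatible X cl′ = ∀ (S : Pred (Hom X Ω) 0ℓ) →
    ΛX X (cl′ (cl X S)) ⊆ cl (F₀ X) (ΛX X (cl′ S))

  SelfSeparation : ∀ X → (Pred (Hom X Ω) 0ℓ → Pred (Hom X Ω) 0ℓ) → Set₁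
  SelfSeparation X cl′ = ∀ (S : Pred (Hom X Ω) 0ℓ) (d : Fib X) →
    cl′ S ≐ S → Initial X S d → Initial (F₀ X) (ΛX X S) (K X d)

-- α and γ form an antitone Galois connection, d ≤ α S ⇔ S ⊆ γ d, so cl is a
-- closure and α only sees a set up to cl.  If S is cl′-closed and initial for
-- d, then γ d = cl S and K d = α (Λ (cl S)); compatibility says Λ (cl S) lies
-- in cl (Λ S), which is exactly α (Λ (cl S)) ≈ α (Λ S).  Conversely,
-- self-separation at the closed set cl′ S, initial for its own α, gives
-- Λ (cl (cl′ S)) ⊆ cl (Λ (cl′ S)), and cl′ (cl S) ⊆ cl (cl′ S) since cl′ ⊆ cl.
module Submission where

open import Defs
open import Level using (Level; 0ℓ)
open import Relation.Unary using (Pred; _⊆_; _≐_)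
open import Function.Bundles using (_⇔_; mk⇔)
open import Relation.Binary.Bundles using (Poset)
open import Data.Product using (_,_; proj₁; proj₂)

module SettingProperties {o : Level} (C : Category o) (Φ : MeetFibration C)
                         (Ω : Category.Obj C) (dΩ : MeetFibration.Fib Φ Ω)
                         (F : Endofunctor C) (Λ : Set)
                         (ev : Λ → Category.Hom C (Endofunctor.F₀ F Ω) Ω) where
  open Category C
  open MeetFibration Φ
  open Endofunctor F
  open Setting C Φ Ω dΩ F Λ ev

  module P (Y : Obj) = Poset (fib Y)

  α-antitone : ∀ Y {S T : Pred (Hom Y Ω) 0ℓ} → S ⊆ T → P._≤_ Y (α Y T) (α Y S)
  α-antitone Y S⊆T = ⋀-glb Y _ _ (λ { (k , k∈S) → ⋀-lb Y _ (k , S⊆T k∈S) })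

  γ-antitone : ∀ Y {d e : Fib Y} → P._≤_ Y d e → γ Y e ⊆ γ Y d
  γ-antitone Y d≤e e≤k* = P.trans Y d≤e e≤k*

  ⊆γ⇒≤α : ∀ Y {S : Pred (Hom Y Ω) 0ℓ} {d : Fib Y} → S ⊆ γ Y d → P._≤_ Y d (α Y S)
  ⊆γ⇒≤α Y S⊆γd = ⋀-glb Y _ _ (λ { (k , k∈S) → S⊆γd k∈S })

  ≤α⇒⊆γ : ∀ Y {S : Pred (Hom Y Ω) 0ℓ} {d : Fib Y} → P._≤_ Y d (α Y S) → S ⊆ γ Y d
  ≤α⇒⊆γ Y {S} d≤αS {k} k∈S = P.trans Y d≤αS (⋀-lb Y _ (k , k∈S))

  cl-extensive : ∀ Y (S : Pred (Hom Y Ω) 0ℓ) → S ⊆ cl Y S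
  cl-extensive Y S = ≤α⇒⊆γ Y (P.refl Y)

  cl-monotone : ∀ Y {S T : Pred (Hom Y Ω) 0ℓ} → S ⊆ T → cl Y S ⊆ cl Y T
  cl-monotone Y S⊆T = γ-antitone Y (α-antitone Y S⊆T)

  cl-idempotent : ∀ Y (S : Pred (Hom Y Ω) 0ℓ) → cl Y (cl Y S) ⊆ cl Y S
  cl-idempotent Y S = γ-antitone Y (⊆γ⇒≤α Y (λ k∈clS → k∈clS))

  α-≈⇒cl-⊆ : ∀ Y {S T : Pred (Hom Y Ω) 0ℓ} → P._≈_ Y (α Y S) (α Y T) → cl Y T ⊆ cl Y S
  α-≈⇒cl-⊆ Y αS≈αT = γ-antitone Y (P.reflexive Y αS≈αT)

  α-≈-between-cl : ∀ Y {S T : Pred (Hom Y Ω) 0ℓ} → S ⊆ T → T ⊆ cl Y S →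
                   P._≈_ Y (α Y S) (α Y T)
  α-≈-between-cl Y S⊆T T⊆clS = P.antisym Y (⊆γ⇒≤α Y T⊆clS) (α-antitone Y S⊆T)

  initial⇒γ≐cl : ∀ Y {S : Pred (Hom Y Ω) 0ℓ} {d : Fib Y} → Initial Y S d → γ Y d ≐ cl Y S
  initial⇒γ≐cl Y αS≈d = γ-antitone Y (P.reflexive Y αS≈d)
                      , γ-antitone Y (P.reflexive Y (P.Eq.sym Y αS≈d))

  ΛX-monotone : ∀ X {S T : Pred (Hom X Ω) 0ℓ} → S ⊆ T → ΛX X S ⊆ ΛX X T
  ΛX-monotone X S⊆T (l , h , h∈S , k≡evFh) = l , h , S⊆T h∈S , k≡evFh

  module _ (X : Obj) (cl′ : Pred (Hom X Ω) 0ℓ → Pred (Hom X Ω) 0ℓ)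
           (cl′-closure : IsClosure cl′) (cl′⊆cl : ∀ S → cl′ S ⊆ cl X S) where
    open IsClosure cl′-closure

    compatible⇒selfSeparation : Compatible X cl′ → SelfSeparation X cl′
    compatible⇒selfSeparation compatible S d (cl′S⊆S , _) αS≈d =
      α-≈-between-cl (F₀ X) (ΛX-monotone X S⊆γd) Λγd⊆clΛS
      where
        γd≐clS : γ X d ≐ cl X S
        γd≐clS = initial⇒γ≐cl X αS≈d

        S⊆γd : S ⊆ γ X d
        S⊆γd k∈S = proj₂ γd≐clS (cl-extensive X S k∈S)

        Λγd⊆clΛS : ΛX X (γ X d) ⊆ cl (F₀ X) (ΛX X S)
        Λγd⊆clΛS k∈Λγd =
          cl-monotone (F₀ X) (ΛX-monotone X cl′S⊆S)
            (compatible S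
              (ΛX-monotone X (extensive (cl X S))
                (ΛX-monotone X (proj₁ γd≐clS) k∈Λγd)))

    selfSeparation⇒compatible : SelfSeparation X cl′ → Compatible X cl′
    selfSeparation⇒compatible selfSeparation S k∈Λcl′clS =
      α-≈⇒cl-⊆ (F₀ X) initial-Λcl′S
        (cl-extensive (F₀ X) _ (ΛX-monotone X cl′clS⊆clcl′S k∈Λcl′clS))
      where
        initial-Λcl′S : Initial (F₀ X) (ΛX X (cl′ S)) (K X (α X (cl′ S)))
        initial-Λcl′S = selfSeparation (cl′ S) (α X (cl′ S)) (idempotent S) (P.Eq.refl X)

        cl′clS⊆clcl′S : cl′ (cl X S) ⊆ cl X (cl′ S)
        cl′clS⊆clcl′S k∈cl′clS =
          cl-monotone X (extensive S) (cl-idempotent X S (cl′⊆cl (cl X S) k∈cl′clS))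

lemma3 : ∀ {o : Level} (C : Category o) (Φ : MeetFibration C)
           (Ω : Category.Obj C) (dΩ : MeetFibration.Fib Φ Ω)
           (F : Endofunctor C) (Λ : Set)
           (ev : Λ → Category.Hom C (Endofunctor.F₀ F Ω) Ω)
           (X : Category.Obj C)
           (cl′ : Pred (Category.Hom C X Ω) 0ℓ → Pred (Category.Hom C X Ω) 0ℓ) →
           IsClosure cl′ →
           (∀ S → cl′ S ⊆ Setting.cl C Φ Ω dΩ F Λ ev X S) →
           Setting.Compatible C Φ Ω dΩ F Λ ev X cl′ ⇔ Setting.SelfSeparation C Φ Ω dΩ F Λ ev X cl′
lemma3 C Φ Ω dΩ F Λ ev X cl′ cl′-closure cl′⊆cl =
  mk⇔ (compatible⇒selfSeparation X cl′ cl′-closure cl′⊆cl)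
      (selfSeparation⇒compatible X cl′ cl′-closure cl′⊆cl)
  where open SettingProperties C Φ Ω dΩ F Λ ev
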